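{- Suppose $\mathcal D$ is equipped with an associative and commutative product $[\cdot,\cdot]$, and let $\varphi:\mathbb{K}(\mathbb{T}^{\mathcal D}_{\mathbf{H}_{CK}})\to\mathbb{K}(\mathcal D)$ be a $\mathbb{K}$-linear map. There exists a unique Hopf algebra morphism $\Phi:\mathbf{H}^{\mathcal D}_{CK}\to\mathbf{Csh}^{\mathcal D}$ such that $\pi\circ\Phi\circ i=\varphi$.
   Context: $\mathbb{K}$ is a field of characteristic zero, $\mathcal D$ a nonempty set. $\mathbf{H}^{\mathcal D}_{CK}$ is the Connes–Kreimer Hopf algebra of rooted forests (up to isomorphism) with vertices decorated by $\mathcal D$ (product the disjoint union; coproduct $\sum_{\boldsymbol v}Lea_{\boldsymbol v}(F)\otimes Roo_{\boldsymbol v}(F)$ over admissible cuts, i.e. sets of vertices pairwise not joined by an oriented path towards the root, $Lea$ being the subforest on vertices above the cut and $Roo$ on the others). $\mathbb{T}^{\mathcal D}_{\mathbf{H}_{CK}}$ is the set of nonempty decorated trees and $i$ the inclusion of their span. $\mathbf{Csh}^{\mathcal D}$ is the quasi-shuffle Hopf algebra: basis the words over $\mathcal D$, coproduct the deconcatenation, product $(v_1\dots v_k)\,\star\,(v_{k+1}\dots v_{k+l})=\sum_{r\ge0}\sum_{\zeta}w_1\dots w_{k+l-r}$ over surjections $\zeta:\{1,\dots,k+l\}\to\{1,\dots,k+l-r\}$ increasing on $\{1,\dots,k\}$ and on $\{k+1,\dots,k+l\}$, where $w_j=v_i$ if $\zeta^{ -1}(j)=\{i\}$ and $w_j=[v_{i_1}v_{i_2}]$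 if $\zeta^{ -1}(j)=\{i_1,i_2\}$. $\pi$ is the projection onto words of length one, identified with $\mathbb{K}(\mathcal D)$. -}

module Defs where

open import Level using (Level; _⊔_) renaming (suc to lsuc)
open import Algebra.Bundles using (CommutativeRing)
open import Data.Nat using (ℕ; zero; suc)
open import Data.List using (List; []; _∷_; _++_; map)
open import Data.Product using (_×_; _,_; ∃)
open import Relation.Nullary using (¬_)
open import Relation.Binary.PropositionalEquality using (_≡_)

record Field (c ℓ : Level) : Set (lsuc (c ⊔ ℓ)) where
  field
    commutativeRing : CommutativeRing c ℓ
  open CommutativeRing commutativeRing
  field
    0≉1     : ¬ (0# ≈ 1#)
    inverse : ∀ x → ¬ (x ≈ 0#) → ∃ λ y → x * y ≈ 1#

module _ {c ℓ} (R : CommutativeRing c ℓ) where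
  open CommutativeRing R
  natMul : ℕ → Carrier
  natMul zero    = 0#
  natMul (suc n) = 1# + natMul n

CharZero : ∀ {c ℓ} → Field c ℓ → Set ℓ
CharZero K = ∀ n → natMul (Field.commutativeRing K) n ≈ 0# → n ≡ 0
  where open CommutativeRing (Field.commutativeRing K)

module HopfCK {c ℓ d} (R : CommutativeRing c ℓ) (D : Set d) (br : D → D → D) where
  open CommutativeRing R renaming (Carrier to K)

  -- Free K-modules: formal finite linear combinations of elements of X.
  -- Two combinations are equal iff every coefficient agrees, which we
  -- express as: they agree under every function X → K respecting the
  -- identification _∼_ of basis elements (e.g. the indicator functions
  -- of the basis classes).

  LC : ∀ {a} → Set a → Set (c ⊔ a)
  LC X = List (K × X)

  single : ∀ {a} {X : Set a} → X → LC X
  single x = (1# , x) ∷ []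

  eval : ∀ {a} {X : Set a} → (X → K) → LC X → K
  eval f []            = 0#
  eval f ((k , x) ∷ v) = k * f x + eval f v

  LCEq : ∀ {a r} {X : Set a} → (X → X → Set r) → LC X → LC X → Set (c ⊔ ℓ ⊔ a ⊔ r)
  LCEq {X = X} _∼_ v w =
    (f : X → K) → (∀ {x y} → x ∼ y → f x ≈ f y) → eval f v ≈ eval f w

  scale : ∀ {a} {X : Set a} → K → LC X → LC X
  scale k = map (λ { (k' , x) → (k * k' , x) })

  ext : ∀ {a b} {X : Set a} {Y : Set b} → (X → LC Y) → LC X → LC Y
  ext g []            = []
  ext g ((k , x) ∷ v) = scale k (g x) ++ ext g v

  bilin : ∀ {a b e} {X : Set a} {Y : Set b} {Z : Set e} →
          (X → Y → LC Z) → LC X → LC Y → LC Z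
  bilin g v w = ext (λ x → ext (λ y → g x y) w) v

  -- tensor product of free modules = free module on pairs of basis elements
  _⊗_ : ∀ {a b} {X : Set a} {Y : Set b} → LC X → LC Y → LC (X × Y)
  v ⊗ w = bilin (λ x y → single (x , y)) v w

  data Tree : Set d where
    node : D → List Tree → Tree

  Forest : Set d
  Forest = List Tree

  -- isomorphism of decorated rooted trees / forests:
  -- generated by permuting children (forests are unordered multisets)
  data _≅T_ : Tree → Tree → Set d
  data _≅F_ : Forest → Forest → Set d

  data _≅T_ where
    node : ∀ {x fs gs} → fs ≅F gs → node x fs ≅T node x gs

  data _≅F_ where
    []    : [] ≅F []
    _∷_   : ∀ {t u fs gs} → t ≅T u → fs ≅F gs → (t ∷ fs) ≅F (u ∷ gs)
    ≅swap : ∀ t u fs → (t ∷ u ∷ fs) ≅F (u ∷ t ∷ fs)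
    ≅trans : ∀ {fs gs hs} → fs ≅F gs → gs ≅F hs → fs ≅F hs

  -- An admissible cut of a tree (a set of pairwise
  -- incomparable vertices) either is {root}, or is a union of admissible
  -- cuts of the subtrees of the root; an admissible cut of a forest is a
  -- family of admissible cuts of its trees.

  data TCut : Tree → Set d
  data FCut : Forest → Set d

  data TCut where
    root  : ∀ {x fs} → TCut (node x fs)
    below : ∀ {x fs} → FCut fs → TCut (node x fs)

  data FCut where
    []  : FCut []
    _∷_ : ∀ {t fs} → TCut t → FCut fs → FCut (t ∷ fs)

  -- Lea: subforest of vertices at or above the cut; Roo: the others
  leaT : ∀ {t} → TCut t → Forest
  rooT : ∀ {t} → TCut t → Forest
  leaF : ∀ {fs} → FCut fs → Forest
  rooF : ∀ {fs} → FCut fs → Forest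

  leaT (root {x} {fs}) = node x fs ∷ []
  leaT (below cs)      = leaF cs
  rooT root            = []
  rooT (below {x} cs)  = node x (rooF cs) ∷ []
  leaF []              = []
  leaF (c ∷ cs)        = leaT c ++ leaF cs
  rooF []              = []
  rooF (c ∷ cs)        = rooT c ++ rooF cs

  -- enumeration of all admissible cuts (each exactly once)
  allTCut : (t : Tree) → List (TCut t)
  allFCut : (fs : Forest) → List (FCut fs)
  consAll : ∀ {t fs} → List (TCut t) → List (FCut fs) → List (FCut (t ∷ fs))
  belowAll : ∀ {x fs} → List (FCut fs) → List (TCut (node x fs))

  allTCut (node x fs) = root ∷ belowAll (allFCut fs)
  allFCut []          = [] ∷ []
  allFCut (t ∷ fs)    = consAll (allTCut t) (allFCut fs)
  consAll []       css = []
  consAll (c ∷ cs) css = map (c ∷_) css ++ consAll cs css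
  belowAll []         = []
  belowAll (cs ∷ css) = below cs ∷ belowAll css

  -- product: disjoint union _++_ ; unit: empty forest []
  -- counit
  εCK : Forest → K
  εCK []      = 1#
  εCK (_ ∷ _) = 0#

  ΔCK : Forest → LC (Forest × Forest)
  ΔCK F = map (λ cut → (1# , (leaF cut , rooF cut))) (allFCut F)

  Word : Set d
  Word = List D

  -- all terms w_1 … w_{k+l-r} of the quasi-shuffle of two words, one for
  -- each surjection ζ as in the definition (classified by ζ⁻¹(1), which
  -- is {1}, {k+1} or {1,k+1})
  qsh : Word → Word → List Word
  qsh []      v       = v ∷ []
  qsh (a ∷ u) []      = (a ∷ u) ∷ []
  qsh (a ∷ u) (b ∷ v) =
    map (a ∷_) (qsh u (b ∷ v)) ++
    (map (b ∷_) (qsh (a ∷ u) v) ++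
     map (br a b ∷_) (qsh u v))

  _⋆_ : LC Word → LC Word → LC Word
  _⋆_ = bilin (λ u v → map (λ w → (1# , w)) (qsh u v))

  εW : Word → K
  εW []      = 1#
  εW (_ ∷ _) = 0#

  deconc : Word → List (Word × Word)
  deconc []      = ([] , []) ∷ []
  deconc (a ∷ u) = ([] , a ∷ u) ∷ map (λ { (p , q) → (a ∷ p , q) }) (deconc u)

  ΔCsh : LC Word → LC (Word × Word)
  ΔCsh = ext (λ w → map (λ pq → (1# , pq)) (deconc w))

  -- projection onto words of length one, identified with K(D)
  πlen1 : Word → LC D
  πlen1 []          = []
  πlen1 (a ∷ [])    = single a
  πlen1 (_ ∷ _ ∷ _) = []

  π : LC Word → LC D
  π = ext πlen1

  _≋W_ : LC Word → LC Word → Set (c ⊔ ℓ ⊔ d)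
  _≋W_ = LCEq _≡_

  _≋WW_ : LC (Word × Word) → LC (Word × Word) → Set (c ⊔ ℓ ⊔ d)
  _≋WW_ = LCEq _≡_

  _≋D_ : LC D → LC D → Set (c ⊔ ℓ ⊔ d)
  _≋D_ = LCEq _≡_

  -- A K-linear map H_CK → Csh is given by its values Φ F on the basis of
  -- forests (well defined on isomorphism classes).  It is a Hopf algebra
  -- morphism iff it is a bialgebra morphism (antipodes are then
  -- automatically preserved).

  record IsHopfMorphism (Φ : Forest → LC Word) : Set (c ⊔ ℓ ⊔ d) where
    field
      well-defined : ∀ {F G} → F ≅F G → Φ F ≋W Φ G
      unit         : Φ [] ≋W single []
      multiplicative : ∀ F G → Φ (F ++ G) ≋W (Φ F ⋆ Φ G)
      counit       : ∀ F → eval εW (Φ F) ≈ εCK F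
      comultiplicative :
        ∀ F → ext (λ { (F₁ , F₂) → Φ F₁ ⊗ Φ F₂ }) (ΔCK F) ≋WW ΔCsh (Φ F)

-- The morphism is forced by the recursion
--   Φ F = ε(F) ∅ + Σ_{admissible cuts} φ̃(Lea) ◁ Φ(Roo),   φ̃ (t₁ ⋯ tₖ) = [φ t₁, …, φ tₖ],
-- where x ◁ w prepends the letter x to the word w. If Ψ is a Hopf morphism with π ∘ Ψ ∘ i = φ, then
-- π (X ⋆ Y) = ε(X) π(Y) + ε(Y) π(X) + [π X, π Y] and multiplicativity give π ∘ Ψ = φ̃ on forests, and
-- splitting off the first letter of a word, w = ε(w) ∅ + Σ_{w = pq} π(p) ◁ q, together with
-- comultiplicativity shows that Ψ satisfies the recursion. As Roo is smaller than F whenever Lea ≠ ∅,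
-- the recursion has at most one solution. Conversely, the Φ it defines is counital with π ∘ Φ = φ̃ by the
-- counit property of cuts, comultiplicative by their coassociativity, and multiplicative because the cuts
-- of F ++ G reproduce the three terms of the quasi-shuffle recursion; associativity and commutativity of
-- [·,·] make φ̃ compatible with concatenation and with isomorphism of forests.

module Submission where

open import Defs
open import Level using (_⊔_)
open import Algebra.Bundles using (CommutativeRing)
open import Data.List using (List; []; _∷_; _++_; map)
open import Data.List.Properties using (++-identityʳ; ++-assoc)
open import Data.Nat as ℕ using (ℕ; zero; suc)
import Data.Nat.Properties as ℕₚ
open import Data.Nat.Induction using (<-wellFounded)
open import Data.Product using (Σ; _×_; _,_)
open import Induction.WellFounded using (module All)
open import Relation.Binary.Construct.On using (wellFounded)
open import Relation.Binary.PropositionalEquality as ≡ using (_≡_)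

measure-induction : ∀ {a p} {A : Set a} (m : A → ℕ) (P : A → Set p) →
                    (∀ x → (∀ {y} → m y ℕ.< m x → P y) → P x) → ∀ x → P x
measure-induction {p = p} m P step = All.wfRec (wellFounded m <-wellFounded) p P step

module CKtoQuasiShuffle {c ℓ d} (R : CommutativeRing c ℓ) (D : Set d) (br : D → D → D) where
  open CommutativeRing R renaming (Carrier to K)
  open HopfCK R D br
  open import Relation.Binary.Reasoning.Setoid setoid
  open import Algebra.Solver.Ring.NaturalCoefficients.Default commutativeSemiring
  open import Algebra.Properties.CommutativeSemigroup ℕₚ.+-commutativeSemigroup
    using () renaming (interchange to ℕ-+-interchange; x∙yz≈y∙xz to ℕ-+-left-comm)
  open import Algebra.Properties.CommutativeSemigroup +-commutativeSemigroup
    using () renaming (interchange to +-interchange)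
  open import Algebra.Properties.CommutativeSemigroup *-commutativeSemigroup
    using (x∙yz≈y∙xz)

  ≡-cong-≈ : ∀ {a} {X : Set a} (f : X → K) {x y} → x ≡ y → f x ≈ f y
  ≡-cong-≈ f ≡.refl = refl

  ∑ : ∀ {a} {A : Set a} → List A → (A → K) → K
  ∑ []       g = 0#
  ∑ (x ∷ xs) g = g x + ∑ xs g

  module _ {a} {A : Set a} where

    ∑-cong : ∀ (xs : List A) {g h : A → K} → (∀ x → g x ≈ h x) → ∑ xs g ≈ ∑ xs h
    ∑-cong []       e = refl
    ∑-cong (x ∷ xs) e = +-cong (e x) (∑-cong xs e)

    ∑-++ : ∀ (xs ys : List A) g → ∑ (xs ++ ys) g ≈ ∑ xs g + ∑ ys g
    ∑-++ []       ys g = sym (+-identityˡ _)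
    ∑-++ (x ∷ xs) ys g = trans (+-congˡ (∑-++ xs ys g)) (sym (+-assoc _ _ _))

    ∑-map : ∀ {b} {B : Set b} (h : A → B) xs (g : B → K) → ∑ (map h xs) g ≈ ∑ xs (λ x → g (h x))
    ∑-map h []       g = refl
    ∑-map h (x ∷ xs) g = +-congˡ (∑-map h xs g)

    ∑-+ : ∀ (xs : List A) g h → ∑ xs (λ x → g x + h x) ≈ ∑ xs g + ∑ xs h
    ∑-+ []       g h = sym (+-identityˡ _)
    ∑-+ (x ∷ xs) g h = trans (+-congˡ (∑-+ xs g h)) (+-interchange _ _ _ _)

    ∑-* : ∀ (xs : List A) k g → ∑ xs (λ x → k * g x) ≈ k * ∑ xs g
    ∑-* []       k g = sym (zeroʳ k)
    ∑-* (x ∷ xs) k g = trans (+-congˡ (∑-* xs k g)) (sym (distribˡ k _ _))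

    ∑-*ʳ : ∀ (xs : List A) k g → ∑ xs (λ x → g x * k) ≈ ∑ xs g * k
    ∑-*ʳ xs k g = trans (∑-cong xs (λ x → *-comm (g x) k)) (trans (∑-* xs k g) (*-comm k _))

    ∑-0 : ∀ (xs : List A) g → (∀ x → g x ≈ 0#) → ∑ xs g ≈ 0#
    ∑-0 []       g e = refl
    ∑-0 (x ∷ xs) g e = trans (+-cong (e x) (∑-0 xs g e)) (+-identityˡ 0#)

  ∑-swap : ∀ {a b} {A : Set a} {B : Set b} (xs : List A) (ys : List B) (h : A → B → K) →
           ∑ xs (λ x → ∑ ys (h x)) ≈ ∑ ys (λ y → ∑ xs (λ x → h x y))
  ∑-swap []       ys h = sym (∑-0 ys _ (λ _ → refl))
  ∑-swap (x ∷ xs) ys h = trans (+-congˡ (∑-swap xs ys h)) (sym (∑-+ ys (h x) _))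

  module _ {a} {X : Set a} where

    eval-cong : ∀ (v : LC X) {f g : X → K} → (∀ x → f x ≈ g x) → eval f v ≈ eval g v
    eval-cong []            e = refl
    eval-cong ((k , x) ∷ v) e = +-cong (*-congˡ (e x)) (eval-cong v e)

    eval-++ : ∀ (v w : LC X) f → eval f (v ++ w) ≈ eval f v + eval f w
    eval-++ []            w f = sym (+-identityˡ _)
    eval-++ ((k , x) ∷ v) w f = trans (+-congˡ (eval-++ v w f)) (sym (+-assoc _ _ _))

    eval-scale : ∀ k (v : LC X) f → eval f (scale k v) ≈ k * eval f v
    eval-scale k []             f = sym (zeroʳ k)
    eval-scale k ((k' , x) ∷ v) f =
      trans (+-cong (*-assoc k k' (f x)) (eval-scale k v f)) (sym (distribˡ k _ _))

    eval-+ : ∀ (v : LC X) f g → eval (λ x → f x + g x) v ≈ eval f v + eval g v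
    eval-+ []            f g = sym (+-identityˡ _)
    eval-+ ((k , x) ∷ v) f g =
      trans (+-cong (distribˡ k _ _) (eval-+ v f g)) (+-interchange _ _ _ _)

    eval-+₃ : ∀ (v : LC X) f g h → eval (λ x → (f x + g x) + h x) v ≈ (eval f v + eval g v) + eval h v
    eval-+₃ v f g h = trans (eval-+ v _ h) (+-congʳ (eval-+ v f g))

    eval-*ˡ : ∀ (v : LC X) k f → eval (λ x → k * f x) v ≈ k * eval f v
    eval-*ˡ []             k f = sym (zeroʳ k)
    eval-*ˡ ((k' , x) ∷ v) k f =
      trans (+-cong (x∙yz≈y∙xz k' k (f x)) (eval-*ˡ v k f)) (sym (distribˡ k _ _))

    eval-*ʳ : ∀ (v : LC X) k f → eval (λ x → f x * k) v ≈ eval f v * k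
    eval-*ʳ v k f = trans (eval-cong v (λ x → *-comm (f x) k)) (trans (eval-*ˡ v k f) (*-comm k _))

    eval-0 : ∀ (v : LC X) f → (∀ x → f x ≈ 0#) → eval f v ≈ 0#
    eval-0 []            f e = refl
    eval-0 ((k , x) ∷ v) f e = trans (+-cong (trans (*-congˡ (e x)) (zeroʳ k)) (eval-0 v f e)) (+-identityˡ 0#)

    eval-single : ∀ (x : X) f → eval f (single x) ≈ f x
    eval-single x f = trans (+-identityʳ _) (*-identityˡ _)

    eval-units : ∀ {b} {A : Set b} (h : A → X) xs f →
                 eval f (map (λ z → (1# , h z)) xs) ≈ ∑ xs (λ z → f (h z))
    eval-units h []       f = refl
    eval-units h (x ∷ xs) f = +-cong (*-identityˡ _) (eval-units h xs f)

    eval-∑-swap : ∀ {b} {A : Set b} (v : LC X) (ys : List A) (h : X → A → K) →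
                  eval (λ x → ∑ ys (h x)) v ≈ ∑ ys (λ y → eval (λ x → h x y) v)
    eval-∑-swap []            ys h = sym (∑-0 ys _ (λ _ → refl))
    eval-∑-swap ((k , x) ∷ v) ys h = trans (+-cong (sym (∑-* ys k (h x))) (eval-∑-swap v ys h))
      (sym (∑-+ ys (λ y → k * h x y) (λ y → eval (λ x' → h x' y) v)))

  eval-swap : ∀ {a b} {X : Set a} {Y : Set b} (v : LC X) (w : LC Y) (h : X → Y → K) →
              eval (λ x → eval (h x) w) v ≈ eval (λ y → eval (λ x → h x y) v) w
  eval-swap v []            h = eval-0 v _ (λ _ → refl)
  eval-swap v ((k , y) ∷ w) h = trans (eval-+ v _ _)
    (+-cong (eval-*ˡ v k _) (eval-swap v w h))

  eval-ext : ∀ {a b} {X : Set a} {Y : Set b} (g : X → LC Y) (v : LC X) f →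
             eval f (ext g v) ≈ eval (λ x → eval f (g x)) v
  eval-ext g []            f = refl
  eval-ext g ((k , x) ∷ v) f =
    trans (eval-++ (scale k (g x)) (ext g v) f) (+-cong (eval-scale k (g x) f) (eval-ext g v f))

  eval-bilin : ∀ {a b e} {X : Set a} {Y : Set b} {Z : Set e} (g : X → Y → LC Z) v w f →
               eval f (bilin g v w) ≈ eval (λ x → eval (λ y → eval f (g x y)) w) v
  eval-bilin g v w f = trans (eval-ext _ v f) (eval-cong v (λ x → eval-ext _ w f))

  eval-bilin-single : ∀ {a b e} {X : Set a} {Y : Set b} {Z : Set e} (g : X → Y → Z) v w f →
                      eval f (bilin (λ x y → single (g x y)) v w) ≈ eval (λ x → eval (λ y → f (g x y)) w) v
  eval-bilin-single g v w f =
    trans (eval-bilin _ v w f) (eval-cong v (λ x → eval-cong w (λ y → eval-single (g x y) f)))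

  eval-⊗ : ∀ {a b} {X : Set a} {Y : Set b} (v : LC X) (w : LC Y) f →
           eval f (v ⊗ w) ≈ eval (λ x → eval (λ y → f (x , y)) w) v
  eval-⊗ = eval-bilin-single _,_

  _◁_ : LC D → LC Word → LC Word
  A ◁ X = bilin (λ a w → single (a ∷ w)) A X

  bracket : LC D → LC D → LC D
  bracket A B = bilin (λ a b → single (br a b)) A B

  eval-◁ : ∀ A X f → eval f (A ◁ X) ≈ eval (λ a → eval (λ w → f (a ∷ w)) X) A
  eval-◁ = eval-bilin-single _∷_

  eval-bracket : ∀ A B f → eval f (bracket A B) ≈ eval (λ a → eval (λ b → f (br a b)) B) A
  eval-bracket = eval-bilin-single br

  -- Opaque, so that unification recovers the summand h from a goal of the form cutSum F h.
  opaque
    cutSum : Forest → (Forest → Forest → K) → K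
    cutSum F h = ∑ (allFCut F) (λ cu → h (leaF cu) (rooF cu))

    treeCutSum : Tree → (Forest → Forest → K) → K
    treeCutSum t h = ∑ (allTCut t) (λ cu → h (leaT cu) (rooT cu))

    eval-ΔCK : ∀ {a} {Y : Set a} F (g : Forest × Forest → LC Y) f →
               eval f (ext g (ΔCK F)) ≈ cutSum F (λ L R → eval f (g (L , R)))
    eval-ΔCK F g f = trans (eval-ext g (ΔCK F) f) (eval-units (λ cu → (leaF cu , rooF cu)) (allFCut F) _)

    cutSum-cong : ∀ F {h h' : Forest → Forest → K} → (∀ L R → h L R ≈ h' L R) →
                  cutSum F h ≈ cutSum F h'
    cutSum-cong F e = ∑-cong (allFCut F) (λ cu → e (leaF cu) (rooF cu))

    treeCutSum-cong : ∀ t {h h' : Forest → Forest → K} → (∀ L R → h L R ≈ h' L R) →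
                      treeCutSum t h ≈ treeCutSum t h'
    treeCutSum-cong t e = ∑-cong (allTCut t) (λ cu → e (leaT cu) (rooT cu))

    cutSum-+ : ∀ F g h → cutSum F (λ L R → g L R + h L R) ≈ cutSum F g + cutSum F h
    cutSum-+ F g h = ∑-+ (allFCut F) _ _

    cutSum-* : ∀ F k h → cutSum F (λ L R → k * h L R) ≈ k * cutSum F h
    cutSum-* F k h = ∑-* (allFCut F) k _

    cutSum-0 : ∀ F h → (∀ L R → h L R ≈ 0#) → cutSum F h ≈ 0#
    cutSum-0 F h e = ∑-0 (allFCut F) _ (λ cu → e _ _)

    cutSum-swap : ∀ A B (h : Forest → Forest → Forest → Forest → K) →
                  cutSum A (λ a b → cutSum B (h a b)) ≈ cutSum B (λ a' b' → cutSum A (λ a b → h a b a' b'))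
    cutSum-swap A B h = ∑-swap (allFCut A) (allFCut B) _

    treeCutSum-swap : ∀ t u (h : Forest → Forest → Forest → Forest → K) →
                      treeCutSum t (λ a b → treeCutSum u (h a b))
                        ≈ treeCutSum u (λ a' b' → treeCutSum t (λ a b → h a b a' b'))
    treeCutSum-swap t u h = ∑-swap (allTCut t) (allTCut u) _

    eval-cutSum-swap : ∀ {a} {X : Set a} (v : LC X) G (h : X → Forest → Forest → K) →
                       eval (λ x → cutSum G (h x)) v ≈ cutSum G (λ L R → eval (λ x → h x L R) v)
    eval-cutSum-swap v G h = eval-∑-swap v (allFCut G) _

    cutSum-[] : ∀ h → cutSum [] h ≈ h [] []
    cutSum-[] h = +-identityʳ _

    cutSum-∷ : ∀ t F h →
               cutSum (t ∷ F) h ≈ treeCutSum t (λ L R → cutSum F (λ L' R' → h (L ++ L') (R ++ R')))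
    cutSum-∷ t F h = ∑-consAll (allTCut t) (allFCut F) _
      where
      ∑-consAll : ∀ {t fs} (X : List (TCut t)) (Y : List (FCut fs)) g →
                  ∑ (consAll X Y) g ≈ ∑ X (λ x → ∑ Y (λ y → g (x ∷ y)))
      ∑-consAll []      Y g = refl
      ∑-consAll (x ∷ X) Y g = trans (∑-++ (map (x ∷_) Y) (consAll X Y) g)
        (+-cong (∑-map (x ∷_) Y g) (∑-consAll X Y g))

    treeCutSum-node : ∀ x fs h →
      treeCutSum (node x fs) h ≈ h (node x fs ∷ []) [] + cutSum fs (λ L R → h L (node x R ∷ []))
    treeCutSum-node x fs h = +-congˡ (reflexive (∑-belowAll (allFCut fs) _))
      where
      ∑-belowAll : ∀ {x fs} (Y : List (FCut fs)) g → ∑ (belowAll {x} Y) g ≡ ∑ Y (λ y → g (below y))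
      ∑-belowAll []      g = ≡.refl
      ∑-belowAll (y ∷ Y) g = ≡.cong (g (below y) +_) (∑-belowAll Y g)

  cutSum-+₃ : ∀ F g h k →
              cutSum F (λ L R → (g L R + h L R) + k L R) ≈ (cutSum F g + cutSum F h) + cutSum F k
  cutSum-+₃ F g h k = trans (cutSum-+ F _ k) (+-congʳ (cutSum-+ F g h))

  cutSum-[t] : ∀ t h → cutSum (t ∷ []) h ≈ treeCutSum t h
  cutSum-[t] t h = trans (cutSum-∷ t [] h) (treeCutSum-cong t (λ L R →
    trans (cutSum-[] _) (reflexive (≡.cong₂ h (++-identityʳ L) (++-identityʳ R)))))

  cutSum-++ : ∀ F G h → cutSum (F ++ G) h ≈ cutSum F (λ L R → cutSum G (λ L' R' → h (L ++ L') (R ++ R')))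
  cutSum-++ []      G h = sym (cutSum-[] _)
  cutSum-++ (t ∷ F) G h = trans (cutSum-∷ t (F ++ G) h) (trans
    (treeCutSum-cong t (λ L R → trans (cutSum-++ F G _) (cutSum-cong F (λ a b → cutSum-cong G (λ a' b' →
      reflexive (≡.cong₂ h (≡.sym (++-assoc L a a')) (≡.sym (++-assoc R b b'))))))))
    (sym (cutSum-∷ t F _)))

  εCK-++ : ∀ A B → εCK (A ++ B) ≈ εCK A * εCK B
  εCK-++ []      B = sym (*-identityˡ _)
  εCK-++ (x ∷ A) B = sym (zeroˡ _)

  treeCutSum-counitˡ : ∀ t (g : Forest → K) → treeCutSum t (λ L R → εCK L * g R) ≈ g (t ∷ [])
  cutSum-counitˡ : ∀ F (g : Forest → K) → cutSum F (λ L R → εCK L * g R) ≈ g F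
  treeCutSum-counitˡ (node x fs) g = trans (treeCutSum-node x fs _)
    (trans (+-cong (zeroˡ _) (cutSum-counitˡ fs _)) (+-identityˡ _))
  cutSum-counitˡ [] g = trans (cutSum-[] _) (*-identityˡ _)
  cutSum-counitˡ (t ∷ F) g = begin
      cutSum (t ∷ F) (λ L R → εCK L * g R)
    ≈⟨ cutSum-∷ t F _ ⟩
      treeCutSum t (λ L R → cutSum F (λ L' R' → εCK (L ++ L') * g (R ++ R')))
    ≈⟨ treeCutSum-cong t (λ L R →
         trans (cutSum-cong F (λ L' R' → trans (*-congʳ (εCK-++ L L')) (*-assoc _ _ _))) (cutSum-* F (εCK L) _)) ⟩
      treeCutSum t (λ L R → εCK L * cutSum F (λ L' R' → εCK L' * g (R ++ R')))
    ≈⟨ treeCutSum-cong t (λ L R → *-congˡ (cutSum-counitˡ F _)) ⟩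
      treeCutSum t (λ L R → εCK L * g (R ++ F))
    ≈⟨ treeCutSum-counitˡ t _ ⟩
      g (t ∷ F)
    ∎

  treeCutSum-counitʳ : ∀ t (g : Forest → K) → treeCutSum t (λ L R → εCK R * g L) ≈ g (t ∷ [])
  treeCutSum-counitʳ (node x fs) g = trans (treeCutSum-node x fs _)
    (trans (+-cong (*-identityˡ _) (cutSum-0 fs _ (λ L R → zeroˡ _))) (+-identityʳ _))
  cutSum-counitʳ : ∀ F (g : Forest → K) → cutSum F (λ L R → εCK R * g L) ≈ g F
  cutSum-counitʳ [] g = trans (cutSum-[] _) (*-identityˡ _)
  cutSum-counitʳ (t ∷ F) g = begin
      cutSum (t ∷ F) (λ L R → εCK R * g L)
    ≈⟨ cutSum-∷ t F _ ⟩
      treeCutSum t (λ L R → cutSum F (λ L' R' → εCK (R ++ R') * g (L ++ L')))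
    ≈⟨ treeCutSum-cong t (λ L R →
         trans (cutSum-cong F (λ L' R' → trans (*-congʳ (εCK-++ R R')) (*-assoc _ _ _))) (cutSum-* F (εCK R) _)) ⟩
      treeCutSum t (λ L R → εCK R * cutSum F (λ L' R' → εCK R' * g (L ++ L')))
    ≈⟨ treeCutSum-cong t (λ L R → *-congˡ (cutSum-counitʳ F _)) ⟩
      treeCutSum t (λ L R → εCK R * g (L ++ F))
    ≈⟨ treeCutSum-counitʳ t _ ⟩
      g (t ∷ F)
    ∎

  treeCutSum-coassoc : ∀ t (h : Forest → Forest → Forest → K) →
    treeCutSum t (λ L R → cutSum L (λ a b → h a b R)) ≈ treeCutSum t (λ L R → cutSum R (λ a b → h L a b))
  cutSum-coassoc : ∀ F (h : Forest → Forest → Forest → K) →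
    cutSum F (λ L R → cutSum L (λ a b → h a b R)) ≈ cutSum F (λ L R → cutSum R (λ a b → h L a b))
  treeCutSum-coassoc (node x fs) h = begin
      treeCutSum (node x fs) (λ L R → cutSum L (λ a b → h a b R))
    ≈⟨ treeCutSum-node x fs _ ⟩
      cutSum (node x fs ∷ []) (λ a b → h a b [])
        + cutSum fs (λ L R → cutSum L (λ a b → h a b (node x R ∷ [])))
    ≈⟨ +-cong (trans (cutSum-[t] (node x fs) _) (treeCutSum-node x fs _)) (cutSum-coassoc fs _) ⟩
      (h (node x fs ∷ []) [] [] + cutSum fs (λ a b → h a (node x b ∷ []) []))
        + cutSum fs (λ L R → cutSum R (λ a b → h L a (node x b ∷ [])))
    ≈⟨ +-assoc _ _ _ ⟩
      h (node x fs ∷ []) [] [] + (cutSum fs (λ a b → h a (node x b ∷ []) [])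
        + cutSum fs (λ L R → cutSum R (λ a b → h L a (node x b ∷ []))))
    ≈⟨ +-cong (sym (cutSum-[] _)) (trans (sym (cutSum-+ fs _ _))
         (cutSum-cong fs (λ L R → trans (sym (treeCutSum-node x R _)) (sym (cutSum-[t] (node x R) _))))) ⟩
      cutSum [] (λ a b → h (node x fs ∷ []) a b)
        + cutSum fs (λ L R → cutSum (node x R ∷ []) (λ a b → h L a b))
    ≈⟨ sym (treeCutSum-node x fs _) ⟩
      treeCutSum (node x fs) (λ L R → cutSum R (λ a b → h L a b))
    ∎
  cutSum-coassoc [] h = trans (cutSum-[] _) (trans (cutSum-[] _)
     (sym (trans (cutSum-[] _) (cutSum-[] _))))
  cutSum-coassoc (t ∷ F) h = begin
      cutSum (t ∷ F) (λ L R → cutSum L (λ a b → h a b R))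
    ≈⟨ cutSum-∷ t F _ ⟩
      treeCutSum t (λ L R → cutSum F (λ L' R' → cutSum (L ++ L') (λ a b → h a b (R ++ R'))))
    ≈⟨ treeCutSum-cong t (λ L R →
         trans (cutSum-cong F (λ L' R' → cutSum-++ L L' _)) (sym (cutSum-swap L F _))) ⟩
      treeCutSum t (λ L R → cutSum L (λ a b →
        cutSum F (λ L' R' → cutSum L' (λ a' b' → h (a ++ a') (b ++ b') (R ++ R')))))
    ≈⟨ treeCutSum-cong t (λ L R → cutSum-cong L (λ a b → cutSum-coassoc F _)) ⟩
      treeCutSum t (λ L R → cutSum L (λ a b →
        cutSum F (λ L' R' → cutSum R' (λ a' b' → h (a ++ L') (b ++ a') (R ++ b')))))
    ≈⟨ treeCutSum-coassoc t _ ⟩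
      treeCutSum t (λ L R → cutSum R (λ a b →
        cutSum F (λ L' R' → cutSum R' (λ a' b' → h (L ++ L') (a ++ a') (b ++ b')))))
    ≈⟨ treeCutSum-cong t (λ L R →
         trans (cutSum-swap R F _) (cutSum-cong F (λ L' R' → sym (cutSum-++ R R' _)))) ⟩
      treeCutSum t (λ L R → cutSum F (λ L' R' → cutSum (R ++ R') (λ a b → h (L ++ L') a b)))
    ≈⟨ sym (cutSum-∷ t F _) ⟩
      cutSum (t ∷ F) (λ L R → cutSum R (λ a b → h L a b))
    ∎

  sizeT : Tree → ℕ
  sizeF : Forest → ℕ
  sizeT (node x fs) = suc (sizeF fs)
  sizeF []      = 0
  sizeF (t ∷ F) = sizeT t ℕ.+ sizeF F

  sizeF-++ : ∀ A B → sizeF (A ++ B) ≡ sizeF A ℕ.+ sizeF B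
  sizeF-++ []      B = ≡.refl
  sizeF-++ (t ∷ A) B = ≡.trans (≡.cong (sizeT t ℕ.+_) (sizeF-++ A B)) (≡.sym (ℕₚ.+-assoc (sizeT t) _ _))

  treeCut-size : ∀ {t} (cu : TCut t) → sizeF (leaT cu) ℕ.+ sizeF (rooT cu) ≡ sizeT t
  forestCut-size : ∀ {F} (cu : FCut F) → sizeF (leaF cu) ℕ.+ sizeF (rooF cu) ≡ sizeF F
  treeCut-size root = ≡.trans (ℕₚ.+-identityʳ _) (ℕₚ.+-identityʳ _)
  treeCut-size (below cs) = ≡.trans (≡.cong (sizeF (leaF cs) ℕ.+_) (ℕₚ.+-identityʳ _))
    (≡.trans (ℕₚ.+-suc (sizeF (leaF cs)) _) (≡.cong suc (forestCut-size cs)))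
  forestCut-size [] = ≡.refl
  forestCut-size (c ∷ cs) =
    ≡.trans (≡.cong₂ ℕ._+_ (sizeF-++ (leaT c) (leaF cs)) (sizeF-++ (rooT c) (rooF cs)))
      (≡.trans (ℕ-+-interchange (sizeF (leaT c)) _ _ _) (≡.cong₂ ℕ._+_ (treeCut-size c) (forestCut-size cs)))

  opaque
    unfolding cutSum
    cutSum-cong-sized : ∀ F {h h' : Forest → Forest → K} →
                        (∀ L R → sizeF L ℕ.+ sizeF R ≡ sizeF F → h L R ≈ h' L R) →
                        cutSum F h ≈ cutSum F h'
    cutSum-cong-sized F e = ∑-cong (allFCut F) (λ cu → e (leaF cu) (rooF cu) (forestCut-size cu))

  cutSum-cong-≤ : ∀ F {h h' : Forest → Forest → K} →
                  (∀ L R → sizeF R ℕ.≤ sizeF F → h L R ≈ h' L R) → cutSum F h ≈ cutSum F h'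
  cutSum-cong-≤ F e =
    cutSum-cong-sized F (λ L R eq → e L R (≡.subst (sizeF R ℕ.≤_) eq (ℕₚ.m≤n+m _ (sizeF L))))

  cutSum-cong-< : ∀ F {h h' : Forest → Forest → K} → (∀ R → h [] R ≈ h' [] R) →
                  (∀ t L R → sizeF R ℕ.< sizeF F → h (t ∷ L) R ≈ h' (t ∷ L) R) →
                  cutSum F h ≈ cutSum F h'
  cutSum-cong-< F e[] e∷ = cutSum-cong-sized F λ
    { [] R _ → e[] R
    ; (node x fs ∷ L) R eq →
        e∷ (node x fs) L R (≡.subst (sizeF R ℕ.<_) eq (ℕ.s≤s (ℕₚ.m≤n+m (sizeF R) _))) }

  ≅T-refl : ∀ t → t ≅T t
  ≅F-refl : ∀ F → F ≅F F
  ≅T-refl (node x fs) = node (≅F-refl fs)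
  ≅F-refl []      = []
  ≅F-refl (t ∷ F) = ≅T-refl t ∷ ≅F-refl F

  ≅F-++ˡ : ∀ {A A'} B → A ≅F A' → (A ++ B) ≅F (A' ++ B)
  ≅F-++ˡ B []             = ≅F-refl B
  ≅F-++ˡ B (p ∷ q)        = p ∷ ≅F-++ˡ B q
  ≅F-++ˡ B (≅swap t u fs) = ≅swap t u (fs ++ B)
  ≅F-++ˡ B (≅trans p q)   = ≅trans (≅F-++ˡ B p) (≅F-++ˡ B q)

  ≅F-++ʳ : ∀ A {B B'} → B ≅F B' → (A ++ B) ≅F (A ++ B')
  ≅F-++ʳ []      p = p
  ≅F-++ʳ (t ∷ A) p = ≅T-refl t ∷ ≅F-++ʳ A p

  ≅F-move : ∀ t B C → (t ∷ (B ++ C)) ≅F (B ++ (t ∷ C))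
  ≅F-move t []      C = ≅F-refl (t ∷ C)
  ≅F-move t (u ∷ B) C = ≅trans (≅swap t u (B ++ C)) (≅T-refl u ∷ ≅F-move t B C)

  ≅F-++-swap : ∀ A B C → (A ++ (B ++ C)) ≅F (B ++ (A ++ C))
  ≅F-++-swap []      B C = ≅F-refl (B ++ C)
  ≅F-++-swap (t ∷ A) B C = ≅trans (≅T-refl t ∷ ≅F-++-swap A B C) (≅F-move t B (A ++ C))

  ≅T-size : ∀ {t u} → t ≅T u → sizeT t ≡ sizeT u
  ≅F-size : ∀ {F G} → F ≅F G → sizeF F ≡ sizeF G
  ≅T-size (node p) = ≡.cong suc (≅F-size p)
  ≅F-size []             = ≡.refl
  ≅F-size (p ∷ q)        = ≡.cong₂ ℕ._+_ (≅T-size p) (≅F-size q)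
  ≅F-size (≅swap t u fs) = ℕ-+-left-comm (sizeT t) (sizeT u) (sizeF fs)
  ≅F-size (≅trans p q)   = ≡.trans (≅F-size p) (≅F-size q)

  εCK-≅ : ∀ {F G} → F ≅F G → εCK F ≈ εCK G
  εCK-≅ []             = refl
  εCK-≅ (p ∷ q)        = refl
  εCK-≅ (≅swap t u fs) = refl
  εCK-≅ (≅trans p q)   = trans (εCK-≅ p) (εCK-≅ q)

  Respects-≅ : (Forest → Forest → K) → Set (ℓ ⊔ d)
  Respects-≅ h = ∀ {L L' R R'} → L ≅F L' → R ≅F R' → h L R ≈ h L' R'

  treeCutSum-cong-≅ : ∀ {t u} → t ≅T u → ∀ h → Respects-≅ h → treeCutSum t h ≈ treeCutSum u h
  cutSum-cong-≅ : ∀ {F G} → F ≅F G → ∀ h → Respects-≅ h → cutSum F h ≈ cutSum G h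
  treeCutSum-cong-≅ (node {x} {fs} {gs} p) h rh = trans (treeCutSum-node x fs h) (trans
    (+-cong (rh (node p ∷ []) []) (cutSum-cong-≅ p _ (λ q r → rh q (node r ∷ []))))
    (sym (treeCutSum-node x gs h)))
  cutSum-cong-≅ [] h rh = refl
  cutSum-cong-≅ (_∷_ {t} {u} {fs} {gs} p q) h rh = trans (cutSum-∷ t fs h) (trans
    (treeCutSum-cong t (λ L R → cutSum-cong-≅ q (λ L' R' → h (L ++ L') (R ++ R'))
      (λ a b → rh (≅F-++ʳ L a) (≅F-++ʳ R b))))
    (trans (treeCutSum-cong-≅ p _
      (λ a b → cutSum-cong gs (λ L₁ R₁ → rh (≅F-++ˡ L₁ a) (≅F-++ˡ R₁ b))))
    (sym (cutSum-∷ u gs h))))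
  cutSum-cong-≅ (≅swap t u fs) h rh = begin
      cutSum (t ∷ u ∷ fs) h
    ≈⟨ trans (cutSum-∷ t (u ∷ fs) h) (treeCutSum-cong t (λ a b → cutSum-∷ u fs _)) ⟩
      treeCutSum t (λ a b → treeCutSum u (λ a' b' → cutSum fs (λ L R → h (a ++ (a' ++ L)) (b ++ (b' ++ R)))))
    ≈⟨ treeCutSum-swap t u _ ⟩
      treeCutSum u (λ a' b' → treeCutSum t (λ a b → cutSum fs (λ L R → h (a ++ (a' ++ L)) (b ++ (b' ++ R)))))
    ≈⟨ treeCutSum-cong u (λ a' b' → treeCutSum-cong t (λ a b → cutSum-cong fs (λ L R →
         rh (≅F-++-swap a a' L) (≅F-++-swap b b' R)))) ⟩
      treeCutSum u (λ a' b' → treeCutSum t (λ a b → cutSum fs (λ L R → h (a' ++ (a ++ L)) (b' ++ (b ++ R)))))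
    ≈⟨ sym (trans (cutSum-∷ u (t ∷ fs) h) (treeCutSum-cong u (λ a b → cutSum-∷ t fs _))) ⟩
      cutSum (u ∷ t ∷ fs) h
    ∎
  cutSum-cong-≅ (≅trans p q) h rh = trans (cutSum-cong-≅ p h rh) (cutSum-cong-≅ q h rh)

  prefix : (Word → K) → D → Word → K
  prefix f a w = f (a ∷ w)

  qshSum : (Word → K) → Word → Word → K
  qshSum f u v = ∑ (qsh u v) f

  qshSum-[]ˡ : ∀ f v → qshSum f [] v ≈ f v
  qshSum-[]ˡ f v = +-identityʳ _

  qshSum-[]ʳ : ∀ f u → qshSum f u [] ≈ f u
  qshSum-[]ʳ f []      = +-identityʳ _
  qshSum-[]ʳ f (a ∷ u) = +-identityʳ _

  qshSum-∷ : ∀ f a u b v → qshSum f (a ∷ u) (b ∷ v) ≈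
             (qshSum (prefix f a) u (b ∷ v) + qshSum (prefix f b) (a ∷ u) v) + qshSum (prefix f (br a b)) u v
  qshSum-∷ f a u b v = trans (∑-++ (map (a ∷_) (qsh u (b ∷ v))) _ f)
    (trans (+-congˡ (∑-++ (map (b ∷_) (qsh (a ∷ u) v)) (map (br a b ∷_) (qsh u v)) f))
    (trans (sym (+-assoc _ _ _))
      (+-cong (+-cong (∑-map (a ∷_) (qsh u (b ∷ v)) f) (∑-map (b ∷_) (qsh (a ∷ u) v) f))
              (∑-map (br a b ∷_) (qsh u v) f))))

  eval-⋆ : ∀ X Y f → eval f (X ⋆ Y) ≈ eval (λ u → eval (qshSum f u) Y) X
  eval-⋆ X Y f =
    trans (eval-bilin _ X Y f) (eval-cong X (λ u → eval-cong Y (λ v → eval-units (λ w → w) (qsh u v) f)))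

  qshSum-εW : ∀ u v → qshSum εW u v ≈ εW u * εW v
  qshSum-εW []      v       = trans (+-identityʳ _) (sym (*-identityˡ _))
  qshSum-εW (a ∷ u) []      = trans (+-identityʳ _) (sym (*-identityʳ _))
  qshSum-εW (a ∷ u) (b ∷ v) = begin
      qshSum εW (a ∷ u) (b ∷ v)
    ≈⟨ qshSum-∷ εW a u b v ⟩
      (qshSum (prefix εW a) u (b ∷ v) + qshSum (prefix εW b) (a ∷ u) v) + qshSum (prefix εW (br a b)) u v
    ≈⟨ +-cong (+-cong (prefixed-vanish a (qsh u (b ∷ v))) (prefixed-vanish b (qsh (a ∷ u) v)))
              (prefixed-vanish (br a b) (qsh u v)) ⟩
      (0# + 0#) + 0#
    ≈⟨ trans (+-identityʳ _) (trans (+-identityʳ _) (sym (zeroˡ _))) ⟩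
      0# * 0#
    ∎
    where
    prefixed-vanish : ∀ c ws → ∑ ws (prefix εW c) ≈ 0#
    prefixed-vanish c ws = ∑-0 ws _ (λ _ → refl)

  evalπ : (D → K) → Word → K
  evalπ G w = eval G (πlen1 w)

  evalπ-∷ : ∀ G a w → evalπ G (a ∷ w) ≈ εW w * G a
  evalπ-∷ G a []      = +-identityʳ _
  evalπ-∷ G a (b ∷ w) = sym (zeroˡ _)

  eval-π : ∀ X G → eval G (π X) ≈ eval (evalπ G) X
  eval-π X G = eval-ext πlen1 X G

  qshSum-prefix-evalπ : ∀ G c u v → qshSum (prefix (evalπ G) c) u v ≈ (εW u * εW v) * G c
  qshSum-prefix-evalπ G c u v =
    trans (∑-cong (qsh u v) (evalπ-∷ G c)) (trans (∑-*ʳ (qsh u v) (G c) εW) (*-congʳ (qshSum-εW u v)))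

  eval-bracket-cong : ∀ A A' B B' → (∀ g → eval g A ≈ eval g A') → (∀ g → eval g B ≈ eval g B') →
                      ∀ G → eval G (bracket A B) ≈ eval G (bracket A' B')
  eval-bracket-cong A A' B B' eA eB G = trans (eval-bracket A B G)
    (trans (trans (eval-cong A (λ a → eB _)) (eA _)) (sym (eval-bracket A' B' G)))

  eval-bracket-πlen1 : ∀ G a u b v →
                       eval G (bracket (πlen1 (a ∷ u)) (πlen1 (b ∷ v))) ≈ εW u * (εW v * G (br a b))
  eval-bracket-πlen1 G a u b v = trans (eval-bracket (πlen1 (a ∷ u)) (πlen1 (b ∷ v)) G)
    (trans (evalπ-∷ _ a u) (*-congˡ (evalπ-∷ (λ b' → G (br a b')) b v)))

  qshSum-evalπ : ∀ G u v → qshSum (evalπ G) u v ≈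
                 (εW u * evalπ G v + εW v * evalπ G u) + eval G (bracket (πlen1 u) (πlen1 v))
  qshSum-evalπ G [] v =
    solve 2 (λ x e → x :+ con 0 := (con 1 :* x :+ e :* con 0) :+ con 0) refl (evalπ G v) (εW v)
  qshSum-evalπ G (a ∷ u) [] = trans
    (solve 1 (λ x → x :+ con 0 := (con 0 :* con 0 :+ con 1 :* x) :+ con 0) refl (evalπ G (a ∷ u)))
    (+-congˡ (sym (trans (eval-bracket (πlen1 (a ∷ u)) [] G) (eval-0 (πlen1 (a ∷ u)) _ (λ _ → refl)))))
  qshSum-evalπ G (a ∷ u) (b ∷ v) = begin
      qshSum (evalπ G) (a ∷ u) (b ∷ v)
    ≈⟨ qshSum-∷ (evalπ G) a u b v ⟩
      (qshSum (prefix (evalπ G) a) u (b ∷ v) + qshSum (prefix (evalπ G) b) (a ∷ u) v)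
        + qshSum (prefix (evalπ G) (br a b)) u v
    ≈⟨ +-cong (+-cong (qshSum-prefix-evalπ G a u (b ∷ v)) (qshSum-prefix-evalπ G b (a ∷ u) v))
              (qshSum-prefix-evalπ G (br a b) u v) ⟩
      ((εW u * 0#) * G a + (0# * εW v) * G b) + (εW u * εW v) * G (br a b)
    ≈⟨ solve 7 (λ eu ev ga gb gab x y → ((eu :* con 0) :* ga :+ (con 0 :* ev) :* gb) :+ (eu :* ev) :* gab
                  := (con 0 :* x :+ con 0 :* y) :+ eu :* (ev :* gab))
         refl (εW u) (εW v) (G a) (G b) (G (br a b)) (evalπ G (b ∷ v)) (evalπ G (a ∷ u)) ⟩
      (0# * evalπ G (b ∷ v) + 0# * evalπ G (a ∷ u)) + εW u * (εW v * G (br a b))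
    ≈⟨ +-congˡ (sym (eval-bracket-πlen1 G a u b v)) ⟩
      (0# * evalπ G (b ∷ v) + 0# * evalπ G (a ∷ u)) + eval G (bracket (πlen1 (a ∷ u)) (πlen1 (b ∷ v)))
    ∎

  eval-bracket-π : ∀ X Y G → eval G (bracket (π X) (π Y)) ≈
                   eval (λ u → eval (λ v → eval G (bracket (πlen1 u) (πlen1 v))) Y) X
  eval-bracket-π X Y G = begin
      eval G (bracket (π X) (π Y))
    ≈⟨ trans (eval-bracket (π X) (π Y) G) (eval-π X _) ⟩
      eval (λ u → eval (λ a → eval (λ b → G (br a b)) (π Y)) (πlen1 u)) X
    ≈⟨ eval-cong X (λ u → eval-cong (πlen1 u) (λ a → eval-π Y _)) ⟩
      eval (λ u → eval (λ a → eval (λ v → evalπ (λ b → G (br a b)) v) Y) (πlen1 u)) X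
    ≈⟨ eval-cong X (λ u → trans (eval-swap (πlen1 u) Y _)
         (eval-cong Y (λ v → sym (eval-bracket (πlen1 u) (πlen1 v) G)))) ⟩
      eval (λ u → eval (λ v → eval G (bracket (πlen1 u) (πlen1 v))) Y) X
    ∎

  π-⋆ : ∀ X Y G → eval G (π (X ⋆ Y)) ≈
        (eval εW X * eval G (π Y) + eval εW Y * eval G (π X)) + eval G (bracket (π X) (π Y))
  π-⋆ X Y G = begin
      eval G (π (X ⋆ Y))
    ≈⟨ trans (eval-π (X ⋆ Y) G) (eval-⋆ X Y (evalπ G)) ⟩
      eval (λ u → eval (qshSum (evalπ G) u) Y) X
    ≈⟨ eval-cong X (λ u → trans (eval-cong Y (qshSum-evalπ G u))
         (trans (eval-+₃ Y _ _ (B u)) (+-congʳ (+-cong (eval-*ˡ Y (εW u) _) (eval-*ʳ Y (evalπ G u) εW))))) ⟩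
      eval (λ u → (εW u * eval (evalπ G) Y + eval εW Y * evalπ G u) + eval (B u) Y) X
    ≈⟨ trans (eval-+₃ X _ _ _)
         (+-congʳ (+-cong (eval-*ʳ X (eval (evalπ G) Y) εW) (eval-*ˡ X (eval εW Y) _))) ⟩
      (eval εW X * eval (evalπ G) Y + eval εW Y * eval (evalπ G) X) + eval (λ u → eval (B u) Y) X
    ≈⟨ +-cong (+-cong (*-congˡ (sym (eval-π Y G))) (*-congˡ (sym (eval-π X G))))
              (sym (eval-bracket-π X Y G)) ⟩
      (eval εW X * eval G (π Y) + eval εW Y * eval G (π X)) + eval G (bracket (π X) (π Y))
    ∎
    where
    B : Word → Word → K
    B u v = eval G (bracket (πlen1 u) (πlen1 v))

  deconcSum : (Word × Word → K) → Word → K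
  deconcSum H w = ∑ (deconc w) H

  eval-ΔCsh : ∀ X H → eval H (ΔCsh X) ≈ eval (deconcSum H) X
  eval-ΔCsh X H = trans (eval-ext _ X H) (eval-cong X (λ w → eval-units (λ pq → pq) (deconc w) H))

  deconcSum-∷ : ∀ H a u →
                deconcSum H (a ∷ u) ≈ H ([] , a ∷ u) + deconcSum (λ (p , q) → H (a ∷ p , q)) u
  deconcSum-∷ H a u = +-congˡ (∑-map _ (deconc u) H)

  firstLetter : (Word → K) → Word × Word → K
  firstLetter f (p , q) = eval (λ a → f (a ∷ q)) (πlen1 p)

  -- w = ε(w) ∅ + Σ_{w = pq} π(p) ◁ q: only the deconcatenation whose left factor is the first letter survives π.
  word-decomposition : ∀ f w → f w ≈ εW w * f [] + deconcSum (firstLetter f) w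
  word-decomposition f [] = solve 1 (λ x → x := con 1 :* x :+ (con 0 :+ con 0)) refl (f [])
  word-decomposition f (a ∷ []) =
    solve 2 (λ x y → x := con 0 :* y :+ (con 0 :+ ((con 1 :* x :+ con 0) :+ con 0))) refl (f (a ∷ [])) (f [])
  word-decomposition f (a ∷ b ∷ u) = trans
    (solve 2 (λ x y → x := con 0 :* y :+ (con 0 :+ ((con 1 :* x :+ con 0) :+ con 0))) refl (f (a ∷ b ∷ u)) (f []))
    (+-congˡ (+-congˡ (+-congˡ (sym longer-prefixes-vanish))))
    where
    longer-prefixes-vanish :
      ∑ (map (λ (p , q) → (a ∷ p , q)) (map (λ (p , q) → (b ∷ p , q)) (deconc u))) (firstLetter f) ≈ 0#
    longer-prefixes-vanish = trans (∑-map _ (map _ (deconc u)) (firstLetter f))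
      (trans (∑-map _ (deconc u) _) (∑-0 (deconc u) _ (λ _ → refl)))

  module Construction (br-assoc : ∀ a b e → br (br a b) e ≡ br a (br b e))
                      (br-comm : ∀ a b → br a b ≡ br b a)
                      (φ : Tree → LC D) (φ-cong : ∀ {t u} → t ≅T u → φ t ≋D φ u) where

    br-swap : ∀ a b e → br (br a b) e ≡ br (br a e) b
    br-swap a b e = ≡.trans (br-assoc a b e) (≡.trans (≡.cong (br a) (br-comm b e)) (≡.sym (br-assoc a e b)))

    -- φ̂ (t₁ … tₖ) a = [a, φ t₁, …, φ tₖ] and φ̃ (t₁ … tₖ) = [φ t₁, …, φ tₖ], with φ̃ [] = 0.
    φ̂ : Forest → D → LC D
    φ̂ []      a = single a
    φ̂ (t ∷ F) a = ext (λ b → φ̂ F (br a b)) (φ t)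

    φ̃ : Forest → LC D
    φ̃ []      = []
    φ̃ (t ∷ F) = ext (φ̂ F) (φ t)

    eval-φ̂-∷ : ∀ t F a g → eval g (φ̂ (t ∷ F) a) ≈ eval (λ b → eval g (φ̂ F (br a b))) (φ t)
    eval-φ̂-∷ t F a g = eval-ext _ (φ t) g

    eval-φ̃-∷ : ∀ t F g → eval g (φ̃ (t ∷ F)) ≈ eval (λ a → eval g (φ̂ F a)) (φ t)
    eval-φ̃-∷ t F g = eval-ext _ (φ t) g

    eval-φ̃-[t] : ∀ t g → eval g (φ̃ (t ∷ [])) ≈ eval g (φ t)
    eval-φ̃-[t] t g = trans (eval-φ̃-∷ t [] g) (eval-cong (φ t) (λ a → eval-single a g))

    φ̂-br : ∀ F a b g → eval (λ x → g (br a x)) (φ̂ F b) ≈ eval g (φ̂ F (br a b))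
    φ̂-br []      a b g = trans (eval-single b (λ x → g (br a x))) (sym (eval-single (br a b) g))
    φ̂-br (t ∷ F) a b g = trans (eval-φ̂-∷ t F b _) (trans
      (eval-cong (φ t) (λ e → trans (φ̂-br F a (br b e) g)
        (≡-cong-≈ (λ z → eval g (φ̂ F z)) (≡.sym (br-assoc a b e)))))
      (sym (eval-φ̂-∷ t F (br a b) g)))

    φ̂-++ : ∀ L L' a g → eval g (φ̂ (L ++ L') a) ≈ eval (λ b → eval g (φ̂ L' b)) (φ̂ L a)
    φ̂-++ []      L' a g = sym (eval-single a (λ b → eval g (φ̂ L' b)))
    φ̂-++ (t ∷ L) L' a g = trans (eval-φ̂-∷ t (L ++ L') a g)
      (trans (eval-cong (φ t) (λ b → φ̂-++ L L' (br a b) g)) (sym (eval-φ̂-∷ t L a _)))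

    φ̃-++ : ∀ L L' g → eval g (φ̃ (L ++ L')) ≈
           (εCK L' * eval g (φ̃ L) + εCK L * eval g (φ̃ L')) + eval g (bracket (φ̃ L) (φ̃ L'))
    φ̃-++ []      L' g =
      solve 2 (λ e x → x := (e :* con 0 :+ con 1 :* x) :+ con 0) refl (εCK L') (eval g (φ̃ L'))
    φ̃-++ (t ∷ L) [] g = trans (≡-cong-≈ (λ z → eval g (φ̃ (t ∷ z))) (++-identityʳ L))
      (trans (solve 1 (λ x → x := (con 1 :* x :+ con 0 :* con 0) :+ con 0) refl (eval g (φ̃ (t ∷ L))))
        (+-congˡ (sym (trans (eval-bracket (φ̃ (t ∷ L)) [] g) (eval-0 (φ̃ (t ∷ L)) _ (λ _ → refl))))))
    φ̃-++ (t ∷ L) (u ∷ L') g = begin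
        eval g (φ̃ (t ∷ (L ++ u ∷ L')))
      ≈⟨ eval-φ̃-∷ t (L ++ u ∷ L') g ⟩
        eval (λ a → eval g (φ̂ (L ++ u ∷ L') a)) (φ t)
      ≈⟨ eval-cong (φ t) (λ a → φ̂-++ L (u ∷ L') a g) ⟩
        eval (λ a → eval (λ b → eval g (φ̂ (u ∷ L') b)) (φ̂ L a)) (φ t)
      ≈⟨ eval-cong (φ t) (λ a → eval-cong (φ̂ L a) (λ b → trans (eval-φ̂-∷ u L' b g)
           (trans (eval-cong (φ u) (λ e → sym (φ̂-br L' b e g)))
                  (sym (eval-φ̃-∷ u L' (λ z → g (br b z))))))) ⟩
        eval (λ a → eval (λ b → eval (λ z → g (br b z)) (φ̃ (u ∷ L'))) (φ̂ L a)) (φ t)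
      ≈⟨ sym (trans (eval-bracket (φ̃ (t ∷ L)) (φ̃ (u ∷ L')) g) (eval-φ̃-∷ t L _)) ⟩
        eval g (bracket (φ̃ (t ∷ L)) (φ̃ (u ∷ L')))
      ≈⟨ solve 3 (λ x y z → z := (con 0 :* x :+ con 0 :* y) :+ z) refl _ _ _ ⟩
        (0# * eval g (φ̃ (t ∷ L)) + 0# * eval g (φ̃ (u ∷ L')))
          + eval g (bracket (φ̃ (t ∷ L)) (φ̃ (u ∷ L')))
      ∎


    φ̂-cong-≅ : ∀ {F G} → F ≅F G → ∀ a g → eval g (φ̂ F a) ≈ eval g (φ̂ G a)
    φ̂-cong-≅ [] a g = refl
    φ̂-cong-≅ (_∷_ {t} {u} {F} {G} p q) a g = begin
        eval g (φ̂ (t ∷ F) a)                     ≈⟨ eval-φ̂-∷ t F a g ⟩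
        eval (λ b → eval g (φ̂ F (br a b))) (φ t) ≈⟨ eval-cong (φ t) (λ b → φ̂-cong-≅ q (br a b) g) ⟩
        eval (λ b → eval g (φ̂ G (br a b))) (φ t) ≈⟨ φ-cong p _ (≡-cong-≈ _) ⟩
        eval (λ b → eval g (φ̂ G (br a b))) (φ u) ≈⟨ sym (eval-φ̂-∷ u G a g) ⟩
        eval g (φ̂ (u ∷ G) a)                     ∎
    φ̂-cong-≅ (≅swap t u fs) a g = begin
        eval g (φ̂ (t ∷ u ∷ fs) a)
      ≈⟨ trans (eval-φ̂-∷ t (u ∷ fs) a g) (eval-cong (φ t) (λ b → eval-φ̂-∷ u fs (br a b) g)) ⟩
        eval (λ b → eval (λ e → eval g (φ̂ fs (br (br a b) e))) (φ u)) (φ t)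
      ≈⟨ eval-swap (φ t) (φ u) (λ b e → eval g (φ̂ fs (br (br a b) e))) ⟩
        eval (λ e → eval (λ b → eval g (φ̂ fs (br (br a b) e))) (φ t)) (φ u)
      ≈⟨ eval-cong (φ u) (λ e → eval-cong (φ t) (λ b →
           ≡-cong-≈ (λ z → eval g (φ̂ fs z)) (br-swap a b e))) ⟩
        eval (λ e → eval (λ b → eval g (φ̂ fs (br (br a e) b))) (φ t)) (φ u)
      ≈⟨ sym (trans (eval-φ̂-∷ u (t ∷ fs) a g) (eval-cong (φ u) (λ e → eval-φ̂-∷ t fs (br a e) g))) ⟩
        eval g (φ̂ (u ∷ t ∷ fs) a)
      ∎
    φ̂-cong-≅ (≅trans p q) a g = trans (φ̂-cong-≅ p a g) (φ̂-cong-≅ q a g)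

    φ̃-cong-≅ : ∀ {F G} → F ≅F G → ∀ g → eval g (φ̃ F) ≈ eval g (φ̃ G)
    φ̃-cong-≅ [] g = refl
    φ̃-cong-≅ (_∷_ {t} {u} {F} {G} p q) g = begin
        eval g (φ̃ (t ∷ F))                ≈⟨ eval-φ̃-∷ t F g ⟩
        eval (λ a → eval g (φ̂ F a)) (φ t) ≈⟨ eval-cong (φ t) (λ a → φ̂-cong-≅ q a g) ⟩
        eval (λ a → eval g (φ̂ G a)) (φ t) ≈⟨ φ-cong p _ (≡-cong-≈ _) ⟩
        eval (λ a → eval g (φ̂ G a)) (φ u) ≈⟨ sym (eval-φ̃-∷ u G g) ⟩
        eval g (φ̃ (u ∷ G))                ∎
    φ̃-cong-≅ (≅swap t u fs) g = begin
        eval g (φ̃ (t ∷ u ∷ fs))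
      ≈⟨ trans (eval-φ̃-∷ t (u ∷ fs) g) (eval-cong (φ t) (λ a → eval-φ̂-∷ u fs a g)) ⟩
        eval (λ a → eval (λ b → eval g (φ̂ fs (br a b))) (φ u)) (φ t)
      ≈⟨ eval-swap (φ t) (φ u) (λ a b → eval g (φ̂ fs (br a b))) ⟩
        eval (λ b → eval (λ a → eval g (φ̂ fs (br a b))) (φ t)) (φ u)
      ≈⟨ eval-cong (φ u) (λ b → eval-cong (φ t) (λ a →
           ≡-cong-≈ (λ z → eval g (φ̂ fs z)) (br-comm a b))) ⟩
        eval (λ b → eval (λ a → eval g (φ̂ fs (br b a))) (φ t)) (φ u)
      ≈⟨ sym (trans (eval-φ̃-∷ u (t ∷ fs) g) (eval-cong (φ u) (λ b → eval-φ̂-∷ t fs b g))) ⟩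
        eval g (φ̃ (u ∷ t ∷ fs))
      ∎
    φ̃-cong-≅ (≅trans p q) g = trans (φ̃-cong-≅ p g) (φ̃-cong-≅ q g)

    cutTerm : (Forest → LC Word) → (D → Word → K) → Forest → Forest → K
    cutTerm X k L R = eval (λ a → eval (k a) (X R)) (φ̃ L)

    cutTerm-cong : ∀ X L R {k k' : D → Word → K} → (∀ a w → k a w ≈ k' a w) →
                   cutTerm X k L R ≈ cutTerm X k' L R
    cutTerm-cong X L R e = eval-cong (φ̃ L) (λ a → eval-cong (X R) (e a))

    cutTerm-+ : ∀ X L R (k k' : D → Word → K) →
                cutTerm X (λ a w → k a w + k' a w) L R ≈ cutTerm X k L R + cutTerm X k' L R
    cutTerm-+ X L R k k' = trans (eval-cong (φ̃ L) (λ a → eval-+ (X R) (k a) (k' a))) (eval-+ (φ̃ L) _ _)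

    cutTerm-+₃ : ∀ X L R (k k' k'' : D → Word → K) →
                 cutTerm X (λ a w → (k a w + k' a w) + k'' a w) L R
                   ≈ (cutTerm X k L R + cutTerm X k' L R) + cutTerm X k'' L R
    cutTerm-+₃ X L R k k' k'' = trans (cutTerm-+ X L R _ k'') (+-congʳ (cutTerm-+ X L R k k'))

    cutTerm-cutSum : ∀ X L R G (h : D → Word → Forest → Forest → K) →
                     cutTerm X (λ a w → cutSum G (h a w)) L R
                       ≈ cutSum G (λ L' R' → cutTerm X (λ a w → h a w L' R') L R)
    cutTerm-cutSum X L R G h = trans (eval-cong (φ̃ L) (λ a → eval-cutSum-swap (X R) G (h a)))
      (eval-cutSum-swap (φ̃ L) G _)

    mergedTerm : (Forest → LC Word) → (D → Word → K) → Forest → Forest → Forest → K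
    mergedTerm X k L L' R = eval (λ a → eval (λ b → eval (k (br a b)) (X R)) (φ̃ L')) (φ̃ L)

    cutTerm-++ : ∀ X k L L' R → cutTerm X k (L ++ L') R ≈
                 (εCK L' * cutTerm X k L R + εCK L * cutTerm X k L' R) + mergedTerm X k L L' R
    cutTerm-++ X k L L' R = trans (φ̃-++ L L' _) (+-congˡ (eval-bracket (φ̃ L) (φ̃ L') _))

    cutSum-cutTerm-cong : ∀ F X Y k →
                          (∀ {R} → sizeF R ℕ.< sizeF F → ∀ a → eval (k a) (X R) ≈ eval (k a) (Y R)) →
                          cutSum F (cutTerm X k) ≈ cutSum F (cutTerm Y k)
    cutSum-cutTerm-cong F X Y k e =
      cutSum-cong-< F (λ R → refl) (λ t L R R<F → eval-cong (φ̃ (t ∷ L)) (e R<F))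

    Recursive : (Forest → LC Word) → Set (c ⊔ ℓ ⊔ d)
    Recursive X = ∀ F f → eval f (X F) ≈ εCK F * f [] + cutSum F (cutTerm X (prefix f))

    recursive-unique : ∀ X Y → Recursive X → Recursive Y → ∀ F f → eval f (X F) ≈ eval f (Y F)
    recursive-unique X Y rec-X rec-Y = measure-induction sizeF (λ F → ∀ f → eval f (X F) ≈ eval f (Y F)) step
      where
      step : ∀ F → (∀ {R} → sizeF R ℕ.< sizeF F → ∀ f → eval f (X R) ≈ eval f (Y R)) →
             ∀ f → eval f (X F) ≈ eval f (Y F)
      step F ih f = trans (rec-X F f) (trans
        (+-congˡ (cutSum-cutTerm-cong F X Y (prefix f) (λ R<F a → ih R<F (prefix f a))))
        (sym (rec-Y F f)))

    -- Fuel exceeding the size suffices: φ̃ [] = 0 kills the cut with empty Lea, the only one not shrinking F.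
    Φ-fuel : ℕ → Forest → LC Word
    Φ-fuel zero    F = (εCK F , []) ∷ []
    Φ-fuel (suc n) F = (εCK F , []) ∷ ext (λ (L , R) → φ̃ L ◁ Φ-fuel n R) (ΔCK F)

    eval-Φ-fuel-suc : ∀ n F f →
                      eval f (Φ-fuel (suc n) F) ≈ εCK F * f [] + cutSum F (cutTerm (Φ-fuel n) (prefix f))
    eval-Φ-fuel-suc n F f =
      +-congˡ (trans (eval-ΔCK F _ f) (cutSum-cong F (λ L R → eval-◁ (φ̃ L) (Φ-fuel n R) f)))

    Φ-fuel-stable : ∀ n m F → sizeF F ℕ.≤ n → sizeF F ℕ.≤ m →
                    ∀ f → eval f (Φ-fuel n F) ≈ eval f (Φ-fuel m F)
    Φ-fuel-stable zero    zero    F               _ _ f = refl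
    Φ-fuel-stable zero    (suc m) []              _ _ f = sym (trans (eval-Φ-fuel-suc m [] f) (+-congˡ (cutSum-[] _)))
    Φ-fuel-stable (suc n) zero    []              _ _ f = trans (eval-Φ-fuel-suc n [] f) (+-congˡ (cutSum-[] _))
    Φ-fuel-stable zero    (suc m) (node _ _ ∷ _) () _ f
    Φ-fuel-stable (suc n) zero    (node _ _ ∷ _) _ () f
    Φ-fuel-stable (suc n) (suc m) F               p q f = trans (eval-Φ-fuel-suc n F f) (trans
      (+-congˡ (cutSum-cutTerm-cong F (Φ-fuel n) (Φ-fuel m) (prefix f) (λ {R} R<F a →
        Φ-fuel-stable n m R (ℕₚ.≤-pred (ℕₚ.≤-trans R<F p)) (ℕₚ.≤-pred (ℕₚ.≤-trans R<F q)) (prefix f a))))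
      (sym (eval-Φ-fuel-suc m F f)))

    Φ : Forest → LC Word
    Φ F = Φ-fuel (sizeF F) F

    Φ-recursive : Recursive Φ
    Φ-recursive [] f = trans (+-identityʳ _) (sym (trans (+-congˡ (cutSum-[] _)) (+-identityʳ _)))
    Φ-recursive F@(node _ fs ∷ G) f = trans (eval-Φ-fuel-suc (sizeF fs ℕ.+ sizeF G) F f)
      (+-congˡ (cutSum-cutTerm-cong F (Φ-fuel (sizeF fs ℕ.+ sizeF G)) Φ (prefix f) (λ {R} R<F a →
        Φ-fuel-stable _ _ R (ℕₚ.≤-pred R<F) ℕₚ.≤-refl (prefix f a))))

    Φ-counit : ∀ F → eval εW (Φ F) ≈ εCK F
    Φ-counit F = trans (Φ-recursive F εW) (trans (+-cong (*-identityʳ _)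
      (cutSum-0 F _ (λ L R → eval-0 (φ̃ L) _ (λ a → eval-0 (Φ R) _ (λ w → refl))))) (+-identityʳ _))

    cutTerm-evalπ : ∀ X G L R → cutTerm X (prefix (evalπ G)) L R ≈ eval εW (X R) * eval G (φ̃ L)
    cutTerm-evalπ X G L R = trans
      (eval-cong (φ̃ L) (λ a → trans (eval-cong (X R) (evalπ-∷ G a)) (eval-*ʳ (X R) (G a) εW)))
      (eval-*ˡ (φ̃ L) (eval εW (X R)) G)

    π-Φ : ∀ F G → eval G (π (Φ F)) ≈ eval G (φ̃ F)
    π-Φ F G = begin
        eval G (π (Φ F))
      ≈⟨ trans (eval-π (Φ F) G) (Φ-recursive F (evalπ G)) ⟩
        εCK F * 0# + cutSum F (cutTerm Φ (prefix (evalπ G)))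
      ≈⟨ +-cong (zeroʳ _) (cutSum-cong F (λ L R → trans (cutTerm-evalπ Φ G L R) (*-congʳ (Φ-counit R)))) ⟩
        0# + cutSum F (λ L R → εCK R * eval G (φ̃ L))
      ≈⟨ trans (+-identityˡ _) (cutSum-counitʳ F _) ⟩
        eval G (φ̃ F)
      ∎

    tensorEval : (Word × Word → K) → LC Word → LC Word → K
    tensorEval H X Y = eval (λ p → eval (λ q → H (p , q)) Y) X

    Comultiplicative-at : Forest → Set (c ⊔ ℓ ⊔ d)
    Comultiplicative-at F = ∀ H → cutSum F (λ L R → tensorEval H (Φ L) (Φ R)) ≈ eval (deconcSum H) (Φ F)

    -- Expanding Φ L by its recursion, coassociativity of cuts regroups the sum into the recursion for Φ F:
    -- deconcatenating a ∷ w either leaves the left factor empty or puts a into it (deconcSum-∷).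
    Φ-comultiplicative-at : ∀ F → Comultiplicative-at F
    Φ-comultiplicative-at = measure-induction sizeF Comultiplicative-at step
      where
      step : ∀ F → (∀ {R} → sizeF R ℕ.< sizeF F → Comultiplicative-at R) → Comultiplicative-at F
      step F ih H = begin
          cutSum F (λ L R → tensorEval H (Φ L) (Φ R))
        ≈⟨ trans (cutSum-cong F (λ L R → Φ-recursive L (λ p → H₀ p R)))
                 (cutSum-+ F _ _) ⟩
          cutSum F (λ L R → εCK L * H₀ [] R) + cutSum F (λ L R → cutSum L (λ L' R' → H₃ L' R' R))
        ≈⟨ +-cong (cutSum-counitˡ F (H₀ [])) (cutSum-coassoc F H₃) ⟩
          H₀ [] F + cutSum F (λ L R → cutSum R (H₃ L))
        ≈⟨ +-cong (Φ-recursive F (λ w → H ([] , w))) (cutSum-cong-< F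
             (λ R → cutSum-0 R (H₃ []) (λ _ _ → refl))
             (λ t L R R<F → trans (sym (eval-cutSum-swap (φ̃ (t ∷ L)) R _))
               (eval-cong (φ̃ (t ∷ L)) (λ a → ih {R} R<F (H₁ a))))) ⟩
          (εCK F * H ([] , []) + cutSum F (cutTerm Φ (λ a w → H ([] , a ∷ w))))
            + cutSum F (cutTerm Φ (λ a → deconcSum (H₁ a)))
        ≈⟨ trans (+-assoc _ _ _) (+-cong (*-congˡ (sym (+-identityʳ _)))
             (trans (sym (cutSum-+ F _ _))
               (cutSum-cong F (λ L R → trans (sym (eval-+ (φ̃ L) _ _))
               (eval-cong (φ̃ L) (λ a → trans (sym (eval-+ (Φ R) _ _))
                 (eval-cong (Φ R) (λ w → sym (deconcSum-∷ H a w))))))))) ⟩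
          εCK F * deconcSum H [] + cutSum F (cutTerm Φ (prefix (deconcSum H)))
        ≈⟨ sym (Φ-recursive F (deconcSum H)) ⟩
          eval (deconcSum H) (Φ F)
        ∎
        where
        H₁ : D → Word × Word → K
        H₁ a (p , q) = H (a ∷ p , q)
        H₀ : Word → Forest → K
        H₀ p R = eval (λ q → H (p , q)) (Φ R)
        H₃ : Forest → Forest → Forest → K
        H₃ L' R' R = cutTerm Φ (λ a w → H₀ (a ∷ w) R) L' R'

    Φ-comultiplicative : ∀ F → ext (λ (L , R) → Φ L ⊗ Φ R) (ΔCK F) ≋WW ΔCsh (Φ F)
    Φ-comultiplicative F H _ = begin
        eval H (ext (λ (L , R) → Φ L ⊗ Φ R) (ΔCK F))
      ≈⟨ trans (eval-ΔCK F _ H) (cutSum-cong F (λ L R → eval-⊗ (Φ L) (Φ R) H)) ⟩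
        cutSum F (λ L R → tensorEval H (Φ L) (Φ R))
      ≈⟨ Φ-comultiplicative-at F H ⟩
        eval (deconcSum H) (Φ F)
      ≈⟨ sym (eval-ΔCsh (Φ F) H) ⟩
        eval H (ΔCsh (Φ F))
      ∎

    Multiplicative-at : Forest → Forest → Set (c ⊔ ℓ ⊔ d)
    Multiplicative-at F G = ∀ f → eval f (Φ (F ++ G)) ≈ eval (λ u → eval (qshSum f u) (Φ G)) (Φ F)

    -- A cut of F ++ G whose Lea lies in F only, in G only, or meets both gives a first letter taken from Φ F,
    -- from Φ G, or a merged letter [a, b]: the three terms of the quasi-shuffle recursion qshSum-∷.
    module MultiplicativeStep (F G : Forest) (f : Word → K)
      (ih : ∀ F' G' → sizeF F' ℕ.+ sizeF G' ℕ.< sizeF F ℕ.+ sizeF G → Multiplicative-at F' G') where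

      εF εG : K
      εF = εCK F
      εG = εCK G

      fromF fromG merged : D → Word → D → Word → K
      fromF  a w b w' = qshSum (prefix f a) w (b ∷ w')
      fromG  a w b w' = qshSum (prefix f b) (a ∷ w) w'
      merged a w b w' = qshSum (prefix f (br a b)) w w'

      thenG : (D → Word → D → Word → K) → D → Word → K
      thenG q a w = cutSum G (cutTerm Φ (q a w))

      shuffled : Word → K
      shuffled u = eval (qshSum f u) (Φ G)

      P₀ P₁ P₂ P₃ P₄ P₅ : K
      P₀ = εF * (εG * f [])
      P₁ = cutSum F (cutTerm Φ (λ a w → εG * f (a ∷ w)))
      P₂ = εF * cutSum G (cutTerm Φ (prefix f))
      P₃ = cutSum F (cutTerm Φ (thenG fromF))
      P₄ = cutSum F (cutTerm Φ (thenG fromG))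
      P₅ = cutSum F (cutTerm Φ (thenG merged))

      shuffled-∷ : ∀ a w →
                   shuffled (a ∷ w) ≈ εG * f (a ∷ w) + ((thenG fromF a w + thenG fromG a w) + thenG merged a w)
      shuffled-∷ a w = trans (Φ-recursive G (qshSum f (a ∷ w))) (+-cong (*-congˡ (qshSum-[]ʳ f (a ∷ w)))
        (trans (cutSum-cong G (λ L' R' → trans (cutTerm-cong Φ L' R' (λ b w' → qshSum-∷ f a w b w'))
          (cutTerm-+₃ Φ L' R' (fromF a w) (fromG a w) (merged a w))))
        (cutSum-+₃ G _ _ _)))

      rhs-expansion : eval shuffled (Φ F) ≈ (P₀ + P₂) + (P₁ + ((P₃ + P₄) + P₅))
      rhs-expansion = trans (Φ-recursive F shuffled) (+-cong
        (trans (*-congˡ (trans (eval-cong (Φ G) (qshSum-[]ˡ f)) (Φ-recursive G f))) (distribˡ εF _ _))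
        (trans (cutSum-cong F (λ L R → trans (cutTerm-cong Φ L R shuffled-∷)
           (trans (cutTerm-+ Φ L R _ _) (+-congˡ (cutTerm-+₃ Φ L R _ _ _)))))
         (trans (cutSum-+ F _ _) (+-congˡ (cutSum-+₃ F _ _ _)))))

      T₁ T₂ T₃ : K
      T₁ = cutSum F (λ L R → cutTerm Φ (prefix f) L (R ++ G))
      T₂ = cutSum G (λ L' R' → cutTerm Φ (prefix f) L' (F ++ R'))
      T₃ = cutSum F (λ L R → cutSum G (λ L' R' → mergedTerm Φ (prefix f) L L' (R ++ R')))

      cuts-of-++ : cutSum (F ++ G) (cutTerm Φ (prefix f)) ≈ (T₁ + T₂) + T₃
      cuts-of-++ = begin
          cutSum (F ++ G) (cutTerm Φ (prefix f))
        ≈⟨ trans (cutSum-++ F G _) (cutSum-cong F (λ L R → trans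
             (cutSum-cong G (λ L' R' → cutTerm-++ Φ (prefix f) L L' (R ++ R'))) (cutSum-+₃ G _ _ _))) ⟩
          cutSum F (λ L R → (cutSum G (λ L' R' → εCK L' * cutTerm Φ (prefix f) L (R ++ R'))
                             + cutSum G (λ L' R' → εCK L * cutTerm Φ (prefix f) L' (R ++ R')))
                             + cutSum G (λ L' R' → mergedTerm Φ (prefix f) L L' (R ++ R')))
        ≈⟨ trans (cutSum-+₃ F _ _ _) (+-congʳ (+-cong
             (cutSum-cong F (λ L R → cutSum-counitˡ G _))
             (trans (cutSum-swap F G _) (cutSum-cong G (λ L' R' → cutSum-counitˡ F _))))) ⟩
          (T₁ + T₂) + T₃
        ∎

      lhs-expansion : eval f (Φ (F ++ G)) ≈ P₀ + ((T₁ + T₂) + T₃)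
      lhs-expansion = trans (Φ-recursive (F ++ G) f)
        (+-cong (trans (*-congʳ (εCK-++ F G)) (*-assoc εF εG (f []))) cuts-of-++)

      cuts-in-F : T₁ ≈ P₁ + P₃
      cuts-in-F = trans (cutSum-cong-< F (λ R → sym (+-identityʳ _)) (λ t L R R<F → begin
          cutTerm Φ (prefix f) (t ∷ L) (R ++ G)
        ≈⟨ eval-cong (φ̃ (t ∷ L)) (λ a → ih R G (ℕₚ.+-monoˡ-< (sizeF G) R<F) (prefix f a)) ⟩
          cutTerm Φ (λ a w → eval (qshSum (prefix f a) w) (Φ G)) (t ∷ L) R
        ≈⟨ cutTerm-cong Φ (t ∷ L) R (λ a w → trans (Φ-recursive G (qshSum (prefix f a) w))
             (+-congʳ (*-congˡ (qshSum-[]ʳ (prefix f a) w)))) ⟩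
          cutTerm Φ (λ a w → εG * f (a ∷ w) + thenG fromF a w) (t ∷ L) R
        ≈⟨ cutTerm-+ Φ (t ∷ L) R _ _ ⟩
          cutTerm Φ (λ a w → εG * f (a ∷ w)) (t ∷ L) R + cutTerm Φ (thenG fromF) (t ∷ L) R
        ∎)) (cutSum-+ F _ _)

      cuts-in-G : T₂ ≈ P₂ + P₄
      cuts-in-G = begin
          T₂
        ≈⟨ cutSum-cong-< G
             (λ R' → sym (trans (+-congʳ (zeroʳ εF)) (trans (+-identityˡ _) (cutSum-0 F _ (λ L R →
               eval-0 (φ̃ L) _ (λ a → eval-0 (Φ R) _ (λ w → refl)))))))
             (λ t L' R' R'<G → begin
                 cutTerm Φ (prefix f) (t ∷ L') (F ++ R')
               ≈⟨ eval-cong (φ̃ (t ∷ L')) (λ b → trans (ih F R' (ℕₚ.+-monoʳ-< (sizeF F) R'<G) (prefix f b))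
                    (trans (Φ-recursive F _) (+-congʳ (*-congˡ (eval-cong (Φ R') (qshSum-[]ˡ (prefix f b))))))) ⟩
                 eval (λ b → εF * eval (prefix f b) (Φ R')
                             + cutSum F (cutTerm Φ (λ a w → eval (qshSum (prefix f b) (a ∷ w)) (Φ R'))))
                      (φ̃ (t ∷ L'))
               ≈⟨ trans (eval-+ (φ̃ (t ∷ L')) _ _)
                    (+-cong (eval-*ˡ (φ̃ (t ∷ L')) εF _) (eval-cutSum-swap (φ̃ (t ∷ L')) F _)) ⟩
                 εF * cutTerm Φ (prefix f) (t ∷ L') R'
                   + cutSum F (λ L R → eval (λ b → cutTerm Φ (λ a w → eval (qshSum (prefix f b) (a ∷ w)) (Φ R')) L R)
                                            (φ̃ (t ∷ L')))
               ≈⟨ +-congˡ (cutSum-cong F (λ L R → trans (eval-swap (φ̃ (t ∷ L')) (φ̃ L) _)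
                    (eval-cong (φ̃ L) (λ a → eval-swap (φ̃ (t ∷ L')) (Φ R) _)))) ⟩
                 εF * cutTerm Φ (prefix f) (t ∷ L') R' + cutSum F (λ L R → term L R (t ∷ L') R')
               ∎) ⟩
          cutSum G (λ L' R' → εF * cutTerm Φ (prefix f) L' R' + cutSum F (λ L R → term L R L' R'))
        ≈⟨ trans (cutSum-+ G _ _)
             (+-cong (cutSum-* G εF (cutTerm Φ (prefix f))) (trans (cutSum-swap G F _)
             (cutSum-cong F (λ L R → sym (cutTerm-cutSum Φ L R G _))))) ⟩
          P₂ + P₄
        ∎
        where
        term : Forest → Forest → Forest → Forest → K
        term L R L' R' = cutTerm Φ (λ a w → cutTerm Φ (fromG a w) L' R') L R

      cuts-in-both : T₃ ≈ P₅
      cuts-in-both = cutSum-cong-< F (λ R → cutSum-0 G _ (λ _ _ → refl)) (λ t L R R<F → trans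
        (cutSum-cong-≤ G (λ L' R' R'≤G → trans
          (eval-cong (φ̃ (t ∷ L)) (λ a → eval-cong (φ̃ L') (λ b →
            ih R R' (ℕₚ.+-mono-<-≤ R<F R'≤G) (prefix f (br a b)))))
          (eval-cong (φ̃ (t ∷ L)) (λ a → eval-swap (φ̃ L') (Φ R) _))))
        (sym (cutTerm-cutSum Φ (t ∷ L) R G _)))

      Φ-++ : eval f (Φ (F ++ G)) ≈ eval shuffled (Φ F)
      Φ-++ = trans lhs-expansion (trans (+-congˡ (+-cong (+-cong cuts-in-F cuts-in-G) cuts-in-both)) (trans
        (solve 6 (λ p₀ p₁ p₂ p₃ p₄ p₅ → p₀ :+ (((p₁ :+ p₃) :+ (p₂ :+ p₄)) :+ p₅)
                                    := (p₀ :+ p₂) :+ (p₁ :+ ((p₃ :+ p₄) :+ p₅))) refl P₀ P₁ P₂ P₃ P₄ P₅)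
        (sym rhs-expansion)))

    Φ-multiplicative-at : ∀ F G → Multiplicative-at F G
    Φ-multiplicative-at F G =
      measure-induction (λ (F , G) → sizeF F ℕ.+ sizeF G) (λ (F , G) → Multiplicative-at F G)
        (λ (F , G) ih f → MultiplicativeStep.Φ-++ F G f (λ F' G' lt → ih {F' , G'} lt)) (F , G)

    Φ-multiplicative : ∀ F G → Φ (F ++ G) ≋W (Φ F ⋆ Φ G)
    Φ-multiplicative F G f _ = trans (Φ-multiplicative-at F G f) (sym (eval-⋆ (Φ F) (Φ G) f))

    Φ-fuel-cong-≅ : ∀ n {F G} → F ≅F G → ∀ f → eval f (Φ-fuel n F) ≈ eval f (Φ-fuel n G)
    Φ-fuel-cong-≅ zero    F≅G f = +-congʳ (*-congʳ (εCK-≅ F≅G))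
    Φ-fuel-cong-≅ (suc n) {F} {G} F≅G f = trans (eval-Φ-fuel-suc n F f) (trans
      (+-cong (*-congʳ (εCK-≅ F≅G)) (cutSum-cong-≅ F≅G (cutTerm (Φ-fuel n) (prefix f))
        (λ {L} {L'} {R} L≅L' R≅R' →
          trans (φ̃-cong-≅ L≅L' _) (eval-cong (φ̃ L') (λ a → Φ-fuel-cong-≅ n R≅R' (prefix f a))))))
      (sym (eval-Φ-fuel-suc n G f)))

    Φ-cong-≅ : ∀ {F G} → F ≅F G → Φ F ≋W Φ G
    Φ-cong-≅ {F} {G} F≅G f _ =
      trans (Φ-fuel-cong-≅ (sizeF F) F≅G f) (≡-cong-≈ (λ n → eval f (Φ-fuel n G)) (≅F-size F≅G))

    Φ-isHopfMorphism : IsHopfMorphism Φ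
    Φ-isHopfMorphism = record
      { well-defined     = Φ-cong-≅
      ; unit             = λ f _ → refl
      ; multiplicative   = Φ-multiplicative
      ; counit           = Φ-counit
      ; comultiplicative = Φ-comultiplicative
      }

    Φ-extends-φ : ∀ t → π (Φ (t ∷ [])) ≋D φ t
    Φ-extends-φ t G _ = trans (π-Φ (t ∷ []) G) (eval-φ̃-[t] t G)

    module _ (Ψ : Forest → LC Word) (Ψ-hopf : IsHopfMorphism Ψ)
             (Ψ-extends-φ : ∀ t → π (Ψ (t ∷ [])) ≋D φ t) where
      open IsHopfMorphism Ψ-hopf

      π-Ψ-[t] : ∀ t G → eval G (π (Ψ (t ∷ []))) ≈ eval G (φ̃ (t ∷ []))
      π-Ψ-[t] t G = trans (Ψ-extends-φ t G (≡-cong-≈ G)) (sym (eval-φ̃-[t] t G))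

      π-Ψ : ∀ L G → eval G (π (Ψ L)) ≈ eval G (φ̃ L)
      π-Ψ []          G =
        trans (eval-π (Ψ []) G) (trans (unit (evalπ G) (≡-cong-≈ _)) (trans (+-identityʳ _) (zeroʳ _)))
      π-Ψ (t ∷ [])    G = π-Ψ-[t] t G
      π-Ψ (t ∷ u ∷ L) G = begin
          eval G (π (Ψ (t ∷ u ∷ L)))
        ≈⟨ trans (eval-π (Ψ (t ∷ u ∷ L)) G) (trans (multiplicative (t ∷ []) (u ∷ L) (evalπ G) (≡-cong-≈ _))
             (sym (eval-π (Ψ (t ∷ []) ⋆ Ψ (u ∷ L)) G))) ⟩
          eval G (π (Ψ (t ∷ []) ⋆ Ψ (u ∷ L)))
        ≈⟨ π-⋆ (Ψ (t ∷ [])) (Ψ (u ∷ L)) G ⟩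
          (eval εW (Ψ (t ∷ [])) * eval G (π (Ψ (u ∷ L)))
            + eval εW (Ψ (u ∷ L)) * eval G (π (Ψ (t ∷ []))))
            + eval G (bracket (π (Ψ (t ∷ []))) (π (Ψ (u ∷ L))))
        ≈⟨ +-cong (+-cong (*-cong (counit (t ∷ [])) (π-Ψ (u ∷ L) G)) (*-cong (counit (u ∷ L)) (π-Ψ-[t] t G)))
                  (eval-bracket-cong (π (Ψ (t ∷ []))) (φ̃ (t ∷ [])) (π (Ψ (u ∷ L))) (φ̃ (u ∷ L))
                                     (π-Ψ-[t] t) (π-Ψ (u ∷ L)) G) ⟩
          (0# * eval G (φ̃ (u ∷ L)) + 0# * eval G (φ̃ (t ∷ [])))
            + eval G (bracket (φ̃ (t ∷ [])) (φ̃ (u ∷ L)))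
        ≈⟨ trans (+-congʳ (+-comm _ _)) (sym (φ̃-++ (t ∷ []) (u ∷ L) G)) ⟩
          eval G (φ̃ (t ∷ u ∷ L))
        ∎

      Ψ-recursive : Recursive Ψ
      Ψ-recursive F f = begin
          eval f (Ψ F)
        ≈⟨ eval-cong (Ψ F) (word-decomposition f) ⟩
          eval (λ w → εW w * f [] + deconcSum (firstLetter f) w) (Ψ F)
        ≈⟨ trans (eval-+ (Ψ F) _ _) (+-congʳ (trans (eval-*ʳ (Ψ F) (f []) εW) (*-congʳ (counit F)))) ⟩
          εCK F * f [] + eval (deconcSum (firstLetter f)) (Ψ F)
        ≈⟨ +-congˡ (begin
              eval (deconcSum (firstLetter f)) (Ψ F)
            ≈⟨ sym (eval-ΔCsh (Ψ F) (firstLetter f)) ⟩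
              eval (firstLetter f) (ΔCsh (Ψ F))
            ≈⟨ sym (comultiplicative F (firstLetter f) (≡-cong-≈ _)) ⟩
              eval (firstLetter f) (ext (λ { (F₁ , F₂) → Ψ F₁ ⊗ Ψ F₂ }) (ΔCK F))
            ≈⟨ trans (eval-ΔCK F _ _) (cutSum-cong F (λ L R → eval-⊗ (Ψ L) (Ψ R) _)) ⟩
              cutSum F (λ L R → eval (λ p → eval (λ q → firstLetter f (p , q)) (Ψ R)) (Ψ L))
            ≈⟨ cutSum-cong F (λ L R → trans (eval-cong (Ψ L) (λ p → sym (eval-swap (πlen1 p) (Ψ R) _)))
                 (trans (sym (eval-π (Ψ L) _)) (π-Ψ L _))) ⟩
              cutSum F (cutTerm Ψ (prefix f))
            ∎) ⟩
          εCK F * f [] + cutSum F (cutTerm Ψ (prefix f))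
        ∎

      Ψ≋Φ : ∀ F → Ψ F ≋W Φ F
      Ψ≋Φ F f _ = recursive-unique Ψ Φ Ψ-recursive Φ-recursive F f

mainTheorem14 :
    ∀ {c ℓ d} (𝕂 : Field c ℓ) → CharZero 𝕂 →
    (D : Set d) (br : D → D → D) →
    (∀ a b e → br (br a b) e ≡ br a (br b e)) →
    (∀ a b → br a b ≡ br b a) →
    let open HopfCK (Field.commutativeRing 𝕂) D br in
    (φ : Tree → LC D) →
    (∀ {t u} → t ≅T u → φ t ≋D φ u) →
    Σ (Forest → LC Word) (λ Φ →
      IsHopfMorphism Φ ×
      (∀ t → π (Φ (t ∷ [])) ≋D φ t) ×
      (∀ (Ψ : Forest → LC Word) → IsHopfMorphism Ψ →
        (∀ t → π (Ψ (t ∷ [])) ≋D φ t) →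
        ∀ F → Ψ F ≋W Φ F))
mainTheorem14 𝕂 _ D br br-assoc br-comm φ φ-cong = Φ , Φ-isHopfMorphism , Φ-extends-φ , Ψ≋Φ
  where
  open CKtoQuasiShuffle (Field.commutativeRing 𝕂) D br
  open Construction br-assoc br-comm φ φ-cong
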